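{- Let $C_n=\frac{1}{n+1}\binom{2n}{n}$ be the Catalan numbers (the number of Dyck paths of length $2n$). For $n\ge 1$ let $\mathcal{H}C_n$ be the total number of humps over all Dyck paths from $(0,0)$ to $(2n,0)$, and set by convention $\mathcal{H}C_0=1$. Then $\mathcal{H}C_1=C_0=C_1=1$, and for every $n\ge 2$, \[ \mathcal{H}C_n=\mathcal{H}C_{n-1}+\sum_{j=1}^{n-1}\left(\mathcal{H}C_{j-1}\cdot C_{n-j}+C_{j-1}\cdot \mathcal{H}C_{n-j}\right). \]
   Context: A Dyck path of length $2n$ is a lattice path from $(0,0)$ to $(2n,0)$ using up-steps $(1,1)$ and down-steps $(1,-1)$ that never goes below the $x$-axis. A hump in a Dyck path is an up-step immediately followed by a down-step. -}

module Defs where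

open import Data.Nat using (ℕ; zero; suc; _+_; _*_; _∸_)
open import Data.Bool using (Bool; true; false; if_then_else_)
open import Data.List using (List; []; _∷_; map; _++_; filter; length)
open import Data.Nat.ListAction using (sum)
open import Data.Nat.DivMod using (_/_)
open import Data.Nat.Combinatorics using (_C_)
open import Relation.Nullary.Decidable using (Dec; yes; no)
open import Relation.Binary.PropositionalEquality using (_≡_; refl)
open import Data.Bool using (_≟_)

-- Steps of a lattice path: U = up-step (1,1), D = down-step (1,-1).
data Step : Set where
  U D : Step

allWords : ℕ → List (List Step)
allWords zero = [] ∷ []
allWords (suc k) = map (U ∷_) (allWords k) ++ map (D ∷_) (allWords k)

dyckFrom : ℕ → List Step → Bool
dyckFrom zero [] = true
dyckFrom (suc h) [] = false
dyckFrom h (U ∷ w) = dyckFrom (suc h) w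
dyckFrom zero (D ∷ w) = false
dyckFrom (suc h) (D ∷ w) = dyckFrom h w

isDyck : List Step → Bool
isDyck = dyckFrom zero

dyckPaths : ℕ → List (List Step)
dyckPaths n = filter (λ w → isDyck w ≟ true) (allWords (2 * n))

humps : List Step → ℕ
humps (U ∷ D ∷ w) = suc (humps (D ∷ w))
humps (_ ∷ w) = humps w
humps [] = 0

Cat : ℕ → ℕ
Cat n = ((2 * n) C n) / suc n

HC : ℕ → ℕ
HC zero = 1
HC (suc m) = sum (map humps (dyckPaths (suc m)))

sumFrom1 : ℕ → (ℕ → ℕ) → ℕ
sumFrom1 zero f = 0
sumFrom1 (suc zero) f = 0
sumFrom1 (suc (suc k)) f = sumFrom1 (suc k) f + f (suc k)

-- Split a nonempty Dyck path at its first return to the axis: w = U p D q with p, q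
-- Dyck paths of semilengths a and b, a + b = n - 1.  Every hump of w is a hump of
-- U p D or of q, so the humps of w number humps (U p D) + humps q.  Summing humps (U p D)
-- over the Dyck paths p of semilength a gives HC a for every a, including a = 0,
-- where the only path U D has one hump; this is exactly the convention HC 0 = 1.
-- Hence HC n = Σ_{a+b=n-1} (HC a · C_b + C_a · H_b), where H_b is the true hump total
-- (H_0 = 0, H_b = HC b otherwise); the term b = 0 is HC (n - 1).  Finally the number
-- of Dyck paths is identified with the closed form of C_n by the reflection principle.

module Submission where

open import Defs
open import Algebra.Properties.CommutativeSemigroup using (interchange; x∙yz≈y∙xz)
open import Data.Bool using (true; false; _≟_)
open import Data.List using (List; []; _∷_; map; _++_; filter)
open import Data.List.Properties using (filter-++; map-++; map-∘)
open import Data.Nat using (ℕ; zero; suc; _+_; _*_; _∸_; _≤_; _<_; s≤s)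
open import Data.Nat.Combinatorics
  using (_C_; nCk+nC[k+1]≡[n+1]C[k+1]; nCk≡nC[n∸k]; nCn≡1; nC1≡n; k>n⇒nCk≡0)
open import Data.Nat.DivMod using (_/_; m*n/n≡m)
open import Data.Nat.ListAction using (sum)
open import Data.Nat.ListAction.Properties using (sum-++)
open import Data.Nat.Properties
  using ( +-comm; *-comm; +-assoc; +-suc; +-identityʳ; *-identityʳ; *-zeroʳ; *-suc
        ; *-distribʳ-+; *-distribˡ-+; +-cancelʳ-≡; +-commutativeSemigroup
        ; n<1+n; m<n⇒m<1+n; m≤n⇒m≤1+n; m≤m+n; m+n∸m≡n; n∸n≡0; +-∸-assoc; ≤-reflexive)
open import Data.Product using (_×_; _,_)
open import Function using (_∘_)
open import Relation.Binary.PropositionalEquality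
open import Relation.Nullary.Decidable using (Dec; does)
open import Relation.Unary using (Pred; Decidable)
open ≡-Reasoning

private
  +-interchange : ∀ a b c d → (a + b) + (c + d) ≡ (a + c) + (b + d)
  +-interchange = interchange +-commutativeSemigroup

  +-left-comm : ∀ a b c → a + (b + c) ≡ b + (a + c)
  +-left-comm = x∙yz≈y∙xz +-commutativeSemigroup

filter-map : ∀ {a b p} {A : Set a} {B : Set b} {P : Pred B p} (P? : Decidable P)
             (g : A → B) xs → filter P? (map g xs) ≡ map g (filter (P? ∘ g) xs)
filter-map P? g []       = refl
filter-map P? g (x ∷ xs) with does (P? (g x))
... | true  = cong (g x ∷_) (filter-map P? g xs)
... | false = filter-map P? g xs

sumFrom1-cong : ∀ n {f g} → (∀ j → suc j < n → f (suc j) ≡ g (suc j)) →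
                sumFrom1 n f ≡ sumFrom1 n g
sumFrom1-cong zero          f≗g = refl
sumFrom1-cong (suc zero)    f≗g = refl
sumFrom1-cong (suc (suc n)) f≗g =
  cong₂ _+_ (sumFrom1-cong (suc n) (λ j j<n → f≗g j (m<n⇒m<1+n j<n))) (f≗g n (n<1+n (suc n)))

sumFrom1-shift : ∀ n f → sumFrom1 (suc (suc n)) f ≡ f 1 + sumFrom1 (suc n) (λ j → f (suc j))
sumFrom1-shift zero    f = sym (+-identityʳ (f 1))
sumFrom1-shift (suc n) f =
  trans (cong (_+ f (suc (suc n))) (sumFrom1-shift n f))
        (+-assoc (f 1) (sumFrom1 (suc n) (λ j → f (suc j))) (f (suc (suc n))))

sumAntidiagonal : ℕ → (ℕ → ℕ → ℕ) → ℕ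
sumAntidiagonal zero    φ = φ 0 0
sumAntidiagonal (suc u) φ = φ 0 (suc u) + sumAntidiagonal u (λ a b → φ (suc a) b)

sumAntidiagonal-cong : ∀ u {φ ψ} → (∀ a b → φ a b ≡ ψ a b) →
                       sumAntidiagonal u φ ≡ sumAntidiagonal u ψ
sumAntidiagonal-cong zero    φ≗ψ = φ≗ψ 0 0
sumAntidiagonal-cong (suc u) φ≗ψ =
  cong₂ _+_ (φ≗ψ 0 (suc u)) (sumAntidiagonal-cong u (λ a b → φ≗ψ (suc a) b))

sumAntidiagonal-+ : ∀ u φ ψ → sumAntidiagonal u (λ a b → φ a b + ψ a b) ≡
                              sumAntidiagonal u φ + sumAntidiagonal u ψ
sumAntidiagonal-+ zero    φ ψ = refl
sumAntidiagonal-+ (suc u) φ ψ =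
  trans (cong (φ 0 (suc u) + ψ 0 (suc u) +_) (sumAntidiagonal-+ u φ′ ψ′))
        (+-interchange (φ 0 (suc u)) (ψ 0 (suc u)) (sumAntidiagonal u φ′) (sumAntidiagonal u ψ′))
  where
  φ′ ψ′ : ℕ → ℕ → ℕ
  φ′ a b = φ (suc a) b
  ψ′ a b = ψ (suc a) b

sumAntidiagonal≡sumFrom1 : ∀ u φ →
  sumAntidiagonal u φ ≡ sumFrom1 (suc (suc u)) (λ j → φ (j ∸ 1) (suc u ∸ j))
sumAntidiagonal≡sumFrom1 zero    φ = refl
sumAntidiagonal≡sumFrom1 (suc u) φ = begin
  φ 0 (suc u) + sumAntidiagonal u (λ a b → φ (suc a) b)
    ≡⟨ cong (φ 0 (suc u) +_) (sumAntidiagonal≡sumFrom1 u (λ a b → φ (suc a) b)) ⟩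
  φ 0 (suc u) + sumFrom1 (suc (suc u)) (λ j → φ (suc (j ∸ 1)) (suc u ∸ j))
    ≡⟨ cong (φ 0 (suc u) +_) (sumFrom1-cong (suc (suc u)) (λ _ _ → refl)) ⟩
  φ 0 (suc u) + sumFrom1 (suc (suc u)) (λ j → φ j (suc u ∸ j))
    ≡⟨ sym (sumFrom1-shift (suc u) (λ j → φ (j ∸ 1) (suc (suc u) ∸ j))) ⟩
  sumFrom1 (suc (suc (suc u))) (λ j → φ (j ∸ 1) (suc (suc u) ∸ j)) ∎

[k+[k+1]]Ck≡[k+[k+1]]C[k+1] : ∀ k → (k + suc k) C k ≡ (k + suc k) C suc k
[k+[k+1]]Ck≡[k+[k+1]]C[k+1] k =
  trans (nCk≡nC[n∸k] (m≤m+n k (suc k))) (cong ((k + suc k) C_) (m+n∸m≡n k (suc k)))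

[n+1]C[k+1]*[k+1]≡[n+1]*nCk : ∀ n k → (suc n C suc k) * suc k ≡ suc n * (n C k)
[n+1]C[k+1]*[k+1]≡[n+1]*nCk zero    zero    = refl
[n+1]C[k+1]*[k+1]≡[n+1]*nCk zero    (suc k) = refl
[n+1]C[k+1]*[k+1]≡[n+1]*nCk (suc n) zero    =
  trans (*-identityʳ _) (trans (nC1≡n (suc (suc n))) (sym (*-identityʳ (suc (suc n)))))
[n+1]C[k+1]*[k+1]≡[n+1]*nCk (suc n) (suc k) = begin
  (suc N C suc (suc k)) * suc (suc k)
    ≡⟨ cong (_* suc (suc k)) (sym (nCk+nC[k+1]≡[n+1]C[k+1] N (suc k))) ⟩
  ((N C suc k) + (N C suc (suc k))) * suc (suc k)
    ≡⟨ *-distribʳ-+ (suc (suc k)) (N C suc k) _ ⟩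
  (N C suc k) * suc (suc k) + (N C suc (suc k)) * suc (suc k)
    ≡⟨ cong (_+ (N C suc (suc k)) * suc (suc k)) (*-suc (N C suc k) (suc k)) ⟩
  ((N C suc k) + (N C suc k) * suc k) + (N C suc (suc k)) * suc (suc k)
    ≡⟨ cong₂ (λ x y → ((N C suc k) + x) + y)
             ([n+1]C[k+1]*[k+1]≡[n+1]*nCk n k) ([n+1]C[k+1]*[k+1]≡[n+1]*nCk n (suc k)) ⟩
  ((N C suc k) + N * (n C k)) + N * (n C suc k)
    ≡⟨ +-assoc (N C suc k) _ _ ⟩
  (N C suc k) + (N * (n C k) + N * (n C suc k))
    ≡⟨ cong ((N C suc k) +_) (sym (*-distribˡ-+ N (n C k) _)) ⟩
  (N C suc k) + N * ((n C k) + (n C suc k))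
    ≡⟨ cong (λ x → (N C suc k) + N * x) (nCk+nC[k+1]≡[n+1]C[k+1] n k) ⟩
  suc N * (N C suc k) ∎
  where
  N : ℕ
  N = suc n

[n+n]C[n+1]*[n+1]≡[n+n]Cn*n : ∀ n → ((n + n) C suc n) * suc n ≡ ((n + n) C n) * n
[n+n]C[n+1]*[n+1]≡[n+n]Cn*n zero    = refl
[n+n]C[n+1]*[n+1]≡[n+n]Cn*n (suc k) = begin
  (suc M C suc (suc k)) * suc (suc k) ≡⟨ [n+1]C[k+1]*[k+1]≡[n+1]*nCk M (suc k) ⟩
  suc M * (M C suc k)                 ≡⟨ cong (suc M *_) (sym ([k+[k+1]]Ck≡[k+[k+1]]C[k+1] k)) ⟩
  suc M * (M C k)                     ≡⟨ sym ([n+1]C[k+1]*[k+1]≡[n+1]*nCk M k) ⟩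
  (suc M C suc k) * suc k             ∎
  where
  M : ℕ
  M = k + suc k

-- dyckSum f h u sums f over the words with u up-steps that go from height h to 0
-- without going below 0 (so they have length h + 2u).  Counting up-steps rather
-- than length keeps odd lengths, which carry no paths, out of every recursion.
dyckSum : (List Step → ℕ) → ℕ → ℕ → ℕ
dyckSum f zero    zero    = f []
dyckSum f zero    (suc u) = dyckSum (λ w → f (U ∷ w)) 1 u
dyckSum f (suc h) zero    = dyckSum (λ w → f (D ∷ w)) h zero
dyckSum f (suc h) (suc u) =
  dyckSum (λ w → f (U ∷ w)) (suc (suc h)) u + dyckSum (λ w → f (D ∷ w)) h (suc u)

dyckCount : ℕ → ℕ → ℕ
dyckCount = dyckSum (λ _ → 1)

dyckSum-cong : ∀ {f g} h u → (∀ w → dyckFrom h w ≡ true → f w ≡ g w) →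
               dyckSum f h u ≡ dyckSum g h u
dyckSum-cong zero    zero    f≗g = f≗g [] refl
dyckSum-cong zero    (suc u) f≗g = dyckSum-cong 1 u (λ w → f≗g (U ∷ w))
dyckSum-cong (suc h) zero    f≗g = dyckSum-cong h zero (λ w → f≗g (D ∷ w))
dyckSum-cong (suc h) (suc u) f≗g =
  cong₂ _+_ (dyckSum-cong (suc (suc h)) u (λ w → f≗g (U ∷ w)))
            (dyckSum-cong h (suc u) (λ w → f≗g (D ∷ w)))

dyckSum-+ : ∀ f g h u → dyckSum (λ w → f w + g w) h u ≡ dyckSum f h u + dyckSum g h u
dyckSum-+ f g zero    zero    = refl
dyckSum-+ f g zero    (suc u) = dyckSum-+ _ _ 1 u
dyckSum-+ f g (suc h) zero    = dyckSum-+ _ _ h zero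
dyckSum-+ f g (suc h) (suc u) = begin
  dyckSum (λ w → fU w + gU w) (suc (suc h)) u + dyckSum (λ w → fD w + gD w) h (suc u)
    ≡⟨ cong₂ _+_ (dyckSum-+ fU gU (suc (suc h)) u) (dyckSum-+ fD gD h (suc u)) ⟩
  (dyckSum fU (suc (suc h)) u + dyckSum gU (suc (suc h)) u)
    + (dyckSum fD h (suc u) + dyckSum gD h (suc u))
    ≡⟨ +-interchange (dyckSum fU (suc (suc h)) u) _ _ _ ⟩
  dyckSum f (suc h) (suc u) + dyckSum g (suc h) (suc u) ∎
  where
  fU gU fD gD : List Step → ℕ
  fU w = f (U ∷ w)
  gU w = g (U ∷ w)
  fD w = f (D ∷ w)
  gD w = g (D ∷ w)

dyckSum-*ʳ : ∀ f c h u → dyckSum (λ w → f w * c) h u ≡ dyckSum f h u * c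
dyckSum-*ʳ f c zero    zero    = refl
dyckSum-*ʳ f c zero    (suc u) = dyckSum-*ʳ _ c 1 u
dyckSum-*ʳ f c (suc h) zero    = dyckSum-*ʳ _ c h zero
dyckSum-*ʳ f c (suc h) (suc u) =
  trans (cong₂ _+_ (dyckSum-*ʳ (λ w → f (U ∷ w)) c (suc (suc h)) u)
                   (dyckSum-*ʳ (λ w → f (D ∷ w)) c h (suc u)))
        (sym (*-distribʳ-+ c (dyckSum (λ w → f (U ∷ w)) (suc (suc h)) u)
                             (dyckSum (λ w → f (D ∷ w)) h (suc u))))

dyckSum-const : ∀ c h u → dyckSum (λ _ → c) h u ≡ dyckCount h u * c
dyckSum-const c h u =
  trans (dyckSum-cong h u (λ _ _ → sym (+-identityʳ c))) (dyckSum-*ʳ (λ _ → 1) c h u)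

dyckCount-zero : ∀ h → dyckCount h 0 ≡ 1
dyckCount-zero zero    = refl
dyckCount-zero (suc h) = dyckCount-zero h

-- Cut the path at its first down-step to height h: the part before it is a path
-- from height k to 0 lifted by h + 1.
dyckSum-firstReturn : ∀ f k h u →
  dyckSum f (suc k + h) u ≡
  sumAntidiagonal u (λ a b → dyckSum (λ p → dyckSum (λ q → f (p ++ D ∷ q)) h b) k a)
dyckSum-firstReturn f zero    h zero    = refl
dyckSum-firstReturn f zero    h (suc u) =
  trans (cong (_+ dyckSum (λ w → f (D ∷ w)) h (suc u))
              (dyckSum-firstReturn (λ w → f (U ∷ w)) 1 h u))
        (+-comm _ (dyckSum (λ w → f (D ∷ w)) h (suc u)))
dyckSum-firstReturn f (suc k) h zero    = dyckSum-firstReturn (λ w → f (D ∷ w)) k h zero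
dyckSum-firstReturn f (suc k) h (suc u) = begin
  dyckSum (λ w → f (U ∷ w)) (suc (suc (suc k + h))) u
    + dyckSum (λ w → f (D ∷ w)) (suc k + h) (suc u)
    ≡⟨ cong₂ _+_ (dyckSum-firstReturn (λ w → f (U ∷ w)) (suc (suc k)) h u)
                 (dyckSum-firstReturn (λ w → f (D ∷ w)) k h (suc u)) ⟩
  sumAntidiagonal u up + (down 0 (suc u) + sumAntidiagonal u (λ a b → down (suc a) b))
    ≡⟨ +-left-comm (sumAntidiagonal u up) (down 0 (suc u)) _ ⟩
  down 0 (suc u) + (sumAntidiagonal u up + sumAntidiagonal u (λ a b → down (suc a) b))
    ≡⟨ cong (down 0 (suc u) +_) (sym (sumAntidiagonal-+ u up (λ a b → down (suc a) b))) ⟩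
  down 0 (suc u) + sumAntidiagonal u (λ a b → up a b + down (suc a) b) ∎
  where
  up down : ℕ → ℕ → ℕ
  up   a b = dyckSum (λ p → dyckSum (λ q → f (U ∷ p ++ D ∷ q)) h b) (suc (suc k)) a
  down a b = dyckSum (λ p → dyckSum (λ q → f (D ∷ p ++ D ∷ q)) h b) k a

-- Reflection principle: reflecting the part after the first visit to height −1 maps
-- the words that dip below 0 onto all words with d + 1 down-steps, so
-- dyckCount h u = C(m, d) − C(m, d + 1) for d = h + u down-steps and length m = d + u.
dyckCount-ballot : ∀ h u {d m} → h + u ≡ d → d + u ≡ m → dyckCount h u + (m C suc d) ≡ m C d
dyckCount-ballot h zero {d} _ d+0≡m rewrite sym d+0≡m | +-identityʳ d =
  trans (cong₂ _+_ (dyckCount-zero h) (k>n⇒nCk≡0 (n<1+n d))) (sym (nCn≡1 d))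
dyckCount-ballot zero (suc u) refl refl = begin
  dyckCount 1 u + (suc M C suc (suc u))
    ≡⟨ cong (dyckCount 1 u +_) (sym (nCk+nC[k+1]≡[n+1]C[k+1] M (suc u))) ⟩
  dyckCount 1 u + ((M C suc u) + (M C suc (suc u)))
    ≡⟨ +-left-comm (dyckCount 1 u) (M C suc u) _ ⟩
  (M C suc u) + (dyckCount 1 u + (M C suc (suc u)))
    ≡⟨ cong ((M C suc u) +_) (dyckCount-ballot 1 u refl (sym (+-suc u u))) ⟩
  (M C suc u) + (M C suc u)
    ≡⟨ cong (_+ (M C suc u)) (sym ([k+[k+1]]Ck≡[k+[k+1]]C[k+1] u)) ⟩
  (M C u) + (M C suc u)
    ≡⟨ nCk+nC[k+1]≡[n+1]C[k+1] M u ⟩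
  suc M C suc u ∎
  where
  M : ℕ
  M = u + suc u
dyckCount-ballot (suc h) (suc u) refl refl = begin
  (dyckCount (suc (suc h)) u + dyckCount h (suc u)) + (suc M C suc (suc d))
    ≡⟨ cong ((dyckCount (suc (suc h)) u + dyckCount h (suc u)) +_)
            (sym (nCk+nC[k+1]≡[n+1]C[k+1] M (suc d))) ⟩
  (dyckCount (suc (suc h)) u + dyckCount h (suc u)) + ((M C suc d) + (M C suc (suc d)))
    ≡⟨ cong (_+ ((M C suc d) + (M C suc (suc d)))) (+-comm (dyckCount (suc (suc h)) u) _) ⟩
  (dyckCount h (suc u) + dyckCount (suc (suc h)) u) + ((M C suc d) + (M C suc (suc d)))
    ≡⟨ +-interchange (dyckCount h (suc u)) _ _ _ ⟩
  (dyckCount h (suc u) + (M C suc d)) + (dyckCount (suc (suc h)) u + (M C suc (suc d)))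
    ≡⟨ cong₂ _+_ (dyckCount-ballot h (suc u) refl refl)
                 (dyckCount-ballot (suc (suc h)) u (cong suc (sym (+-suc h u))) (sym (+-suc d u))) ⟩
  (M C d) + (M C suc d)
    ≡⟨ nCk+nC[k+1]≡[n+1]C[k+1] M d ⟩
  suc M C suc d ∎
  where
  d M : ℕ
  d = h + suc u
  M = d + suc u

Cat≡dyckCount : ∀ n → Cat n ≡ dyckCount 0 n
Cat≡dyckCount n = begin
  ((2 * n) C n) / suc n            ≡⟨ cong (λ m → ((n + m) C n) / suc n) (+-identityʳ n) ⟩
  ((n + n) C n) / suc n            ≡⟨ cong (_/ suc n) (sym count*suc) ⟩
  (dyckCount 0 n * suc n) / suc n  ≡⟨ m*n/n≡m (dyckCount 0 n) (suc n) ⟩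
  dyckCount 0 n                    ∎
  where
  c c′ : ℕ
  c  = (n + n) C n
  c′ = (n + n) C suc n
  count*suc : dyckCount 0 n * suc n ≡ c
  count*suc = +-cancelʳ-≡ (c * n) (dyckCount 0 n * suc n) c (begin
    dyckCount 0 n * suc n + c * n
      ≡⟨ cong (dyckCount 0 n * suc n +_) (sym ([n+n]C[n+1]*[n+1]≡[n+n]Cn*n n)) ⟩
    dyckCount 0 n * suc n + c′ * suc n ≡⟨ sym (*-distribʳ-+ (suc n) (dyckCount 0 n) c′) ⟩
    (dyckCount 0 n + c′) * suc n       ≡⟨ cong (_* suc n) (dyckCount-ballot 0 n refl refl) ⟩
    c * suc n                          ≡⟨ *-suc c n ⟩
    c + c * n                          ∎)

dyckSumOver : (List Step → ℕ) → ℕ → List (List Step) → ℕ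
dyckSumOver f h ws = sum (map f (filter (λ w → dyckFrom h w ≟ true) ws))

dyckSumOver-++ : ∀ f h ws vs →
                 dyckSumOver f h (ws ++ vs) ≡ dyckSumOver f h ws + dyckSumOver f h vs
dyckSumOver-++ f h ws vs = begin
  sum (map f (filter P? (ws ++ vs)))
    ≡⟨ cong (sum ∘ map f) (filter-++ P? ws vs) ⟩
  sum (map f (filter P? ws ++ filter P? vs))
    ≡⟨ cong sum (map-++ f (filter P? ws) (filter P? vs)) ⟩
  sum (map f (filter P? ws) ++ map f (filter P? vs))
    ≡⟨ sum-++ (map f (filter P? ws)) (map f (filter P? vs)) ⟩
  dyckSumOver f h ws + dyckSumOver f h vs ∎
  where
  P? : ∀ w → Dec (dyckFrom h w ≡ true)
  P? w = dyckFrom h w ≟ true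

dyckSumOver-map : ∀ f (g : List Step → List Step) h ws →
  dyckSumOver f h (map g ws) ≡
  sum (map (λ w → f (g w)) (filter (λ w → dyckFrom h (g w) ≟ true) ws))
dyckSumOver-map f g h ws =
  trans (cong (sum ∘ map f) (filter-map (λ w → dyckFrom h w ≟ true) g ws))
        (cong sum (sym (map-∘ {g = f} {f = g} (filter (λ w → dyckFrom h (g w) ≟ true) ws))))

dyckSumOver-D₀ : ∀ f (ws : List (List Step)) → dyckSumOver f 0 (map (D ∷_) ws) ≡ 0
dyckSumOver-D₀ f []       = refl
dyckSumOver-D₀ f (_ ∷ ws) = dyckSumOver-D₀ f ws

dyckSumOver-allWords-suc₀ : ∀ f m →
  dyckSumOver f 0 (allWords (suc m)) ≡ dyckSumOver (λ w → f (U ∷ w)) 1 (allWords m)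
dyckSumOver-allWords-suc₀ f m = begin
  dyckSumOver f 0 (map (U ∷_) (allWords m) ++ map (D ∷_) (allWords m))
    ≡⟨ dyckSumOver-++ f 0 (map (U ∷_) (allWords m)) (map (D ∷_) (allWords m)) ⟩
  dyckSumOver f 0 (map (U ∷_) (allWords m)) + dyckSumOver f 0 (map (D ∷_) (allWords m))
    ≡⟨ cong₂ _+_ (dyckSumOver-map f (U ∷_) 0 (allWords m)) (dyckSumOver-D₀ f (allWords m)) ⟩
  dyckSumOver (λ w → f (U ∷ w)) 1 (allWords m) + 0
    ≡⟨ +-identityʳ _ ⟩
  dyckSumOver (λ w → f (U ∷ w)) 1 (allWords m) ∎

dyckSumOver-allWords-suc : ∀ f h m →
  dyckSumOver f (suc h) (allWords (suc m)) ≡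
  dyckSumOver (λ w → f (U ∷ w)) (suc (suc h)) (allWords m)
    + dyckSumOver (λ w → f (D ∷ w)) h (allWords m)
dyckSumOver-allWords-suc f h m =
  trans (dyckSumOver-++ f (suc h) (map (U ∷_) (allWords m)) (map (D ∷_) (allWords m)))
        (cong₂ _+_ (dyckSumOver-map f (U ∷_) (suc h) (allWords m))
                   (dyckSumOver-map f (D ∷_) (suc h) (allWords m)))

dyckSumOver-allWords-< : ∀ f h m → m < h → dyckSumOver f h (allWords m) ≡ 0
dyckSumOver-allWords-< f (suc h) zero    _         = refl
dyckSumOver-allWords-< f (suc h) (suc m) (s≤s m<h) =
  trans (dyckSumOver-allWords-suc f h m)
        (cong₂ _+_ (dyckSumOver-allWords-< _ (suc (suc h)) m (m<n⇒m<1+n (m<n⇒m<1+n m<h)))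
                   (dyckSumOver-allWords-< _ h m m<h))

dyckSumOver-allWords : ∀ f h u → dyckSumOver f h (allWords (h + u + u)) ≡ dyckSum f h u
dyckSumOver-allWords f zero    zero    = +-identityʳ (f [])
dyckSumOver-allWords f zero    (suc u) = begin
  dyckSumOver f 0 (allWords (suc (u + suc u)))
    ≡⟨ dyckSumOver-allWords-suc₀ f (u + suc u) ⟩
  dyckSumOver (λ w → f (U ∷ w)) 1 (allWords (u + suc u))
    ≡⟨ cong (λ m → dyckSumOver (λ w → f (U ∷ w)) 1 (allWords m)) (+-suc u u) ⟩
  dyckSumOver (λ w → f (U ∷ w)) 1 (allWords (1 + u + u))
    ≡⟨ dyckSumOver-allWords _ 1 u ⟩
  dyckSum f 0 (suc u) ∎
dyckSumOver-allWords f (suc h) zero    =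
  trans (dyckSumOver-allWords-suc f h (h + 0 + 0))
        (cong₂ _+_ (dyckSumOver-allWords-< _ (suc (suc h)) (h + 0 + 0)
                                           (s≤s (m≤n⇒m≤1+n h+0+0≤h)))
                   (dyckSumOver-allWords _ h zero))
  where
  h+0+0≤h : h + 0 + 0 ≤ h
  h+0+0≤h = ≤-reflexive (trans (+-identityʳ (h + 0)) (+-identityʳ h))
dyckSumOver-allWords f (suc h) (suc u) =
  trans (dyckSumOver-allWords-suc f h (h + suc u + suc u))
        (cong₂ _+_ (trans (cong (dyckSumOver (λ w → f (U ∷ w)) (suc (suc h)) ∘ allWords) length-U)
                          (dyckSumOver-allWords _ (suc (suc h)) u))
                   (dyckSumOver-allWords _ h (suc u)))
  where
  length-U : h + suc u + suc u ≡ suc (suc h) + u + u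
  length-U = trans (cong (_+ suc u) (+-suc h u)) (cong suc (+-suc (h + u) u))

totalHumps : ℕ → ℕ
totalHumps = dyckSum humps 0

HC-suc : ∀ n → HC (suc n) ≡ totalHumps (suc n)
HC-suc n = trans (cong (λ m → dyckSumOver humps 0 (allWords (suc n + m))) (+-identityʳ (suc n)))
                 (dyckSumOver-allWords humps 0 (suc n))

humps-++-D : ∀ w v → humps (w ++ D ∷ v) ≡ humps (w ++ D ∷ []) + humps v
humps-++-D []            v = refl
humps-++-D (U ∷ [])      v = refl
humps-++-D (U ∷ U ∷ w)   v = humps-++-D (U ∷ w) v
humps-++-D (U ∷ D ∷ w)   v = cong suc (humps-++-D (D ∷ w) v)
humps-++-D (D ∷ w)       v = humps-++-D w v

humps-∷ʳ-D : ∀ h w → dyckFrom h w ≡ true → humps (w ++ D ∷ []) ≡ humps w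
humps-∷ʳ-D zero    []          _     = refl
humps-∷ʳ-D (suc h) []          ()
humps-∷ʳ-D zero    (U ∷ [])    ()
humps-∷ʳ-D (suc h) (U ∷ [])    ()
humps-∷ʳ-D zero    (U ∷ U ∷ w) dyck = humps-∷ʳ-D 1 (U ∷ w) dyck
humps-∷ʳ-D (suc h) (U ∷ U ∷ w) dyck = humps-∷ʳ-D (suc (suc h)) (U ∷ w) dyck
humps-∷ʳ-D zero    (U ∷ D ∷ w) dyck = cong suc (humps-∷ʳ-D zero w dyck)
humps-∷ʳ-D (suc h) (U ∷ D ∷ w) dyck = cong suc (humps-∷ʳ-D (suc h) w dyck)
humps-∷ʳ-D zero    (D ∷ w)     ()
humps-∷ʳ-D (suc h) (D ∷ w)     dyck = humps-∷ʳ-D h w dyck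

HC≡dyckSum-lifted : ∀ n → HC n ≡ dyckSum (λ p → humps (U ∷ p ++ D ∷ [])) 0 n
HC≡dyckSum-lifted zero    = refl
HC≡dyckSum-lifted (suc n) =
  trans (HC-suc n) (dyckSum-cong 1 n (λ w dyck → sym (humps-∷ʳ-D 0 (U ∷ w) dyck)))

HC-suc≡sumAntidiagonal : ∀ u →
  HC (suc u) ≡ sumAntidiagonal u (λ a b → HC a * Cat b + Cat a * totalHumps b)
HC-suc≡sumAntidiagonal u = begin
  HC (suc u)
    ≡⟨ HC-suc u ⟩
  dyckSum (λ w → humps (U ∷ w)) 1 u
    ≡⟨ dyckSum-firstReturn (λ w → humps (U ∷ w)) 0 0 u ⟩
  sumAntidiagonal u (λ a b → dyckSum (λ p → dyckSum (λ q → humps (U ∷ p ++ D ∷ q)) 0 b) 0 a)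
    ≡⟨ sumAntidiagonal-cong u split ⟩
  sumAntidiagonal u (λ a b → HC a * Cat b + Cat a * totalHumps b) ∎
  where
  lifted : List Step → ℕ
  lifted p = humps (U ∷ p ++ D ∷ [])

  inner : ∀ b p → dyckSum (λ q → humps (U ∷ p ++ D ∷ q)) 0 b ≡
                  lifted p * dyckCount 0 b + totalHumps b
  inner b p = begin
    dyckSum (λ q → humps (U ∷ p ++ D ∷ q)) 0 b
      ≡⟨ dyckSum-cong 0 b (λ q _ → humps-++-D (U ∷ p) q) ⟩
    dyckSum (λ q → lifted p + humps q) 0 b
      ≡⟨ dyckSum-+ (λ _ → lifted p) humps 0 b ⟩
    dyckSum (λ _ → lifted p) 0 b + totalHumps b
      ≡⟨ cong (_+ totalHumps b) (trans (dyckSum-const (lifted p) 0 b) (*-comm (dyckCount 0 b) _)) ⟩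
    lifted p * dyckCount 0 b + totalHumps b ∎

  split : ∀ a b → dyckSum (λ p → dyckSum (λ q → humps (U ∷ p ++ D ∷ q)) 0 b) 0 a ≡
                  HC a * Cat b + Cat a * totalHumps b
  split a b = begin
    dyckSum (λ p → dyckSum (λ q → humps (U ∷ p ++ D ∷ q)) 0 b) 0 a
      ≡⟨ dyckSum-cong 0 a (λ p _ → inner b p) ⟩
    dyckSum (λ p → lifted p * dyckCount 0 b + totalHumps b) 0 a
      ≡⟨ dyckSum-+ (λ p → lifted p * dyckCount 0 b) (λ _ → totalHumps b) 0 a ⟩
    dyckSum (λ p → lifted p * dyckCount 0 b) 0 a + dyckSum (λ _ → totalHumps b) 0 a
      ≡⟨ cong₂ _+_ (dyckSum-*ʳ lifted (dyckCount 0 b) 0 a) (dyckSum-const (totalHumps b) 0 a) ⟩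
    dyckSum lifted 0 a * dyckCount 0 b + dyckCount 0 a * totalHumps b
      ≡⟨ sym (cong₂ _+_ (cong₂ _*_ (HC≡dyckSum-lifted a) (Cat≡dyckCount b))
                        (cong (_* totalHumps b) (Cat≡dyckCount a))) ⟩
    HC a * Cat b + Cat a * totalHumps b ∎

lemma2p3 : (HC 1 ≡ Cat 0 × Cat 0 ≡ Cat 1 × Cat 1 ≡ 1)
    × (∀ n → 2 ≤ n →
        HC n ≡ HC (n ∸ 1)
          + sumFrom1 n (λ j → HC (j ∸ 1) * Cat (n ∸ j) + Cat (j ∸ 1) * HC (n ∸ j)))
lemma2p3 = (refl , refl , refl) , recurrence
  where
  recurrence : ∀ n → 2 ≤ n →
    HC n ≡ HC (n ∸ 1) + sumFrom1 n (λ j → HC (j ∸ 1) * Cat (n ∸ j) + Cat (j ∸ 1) * HC (n ∸ j))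
  recurrence (suc (suc k)) (s≤s (s≤s _)) = begin
    HC (suc u)                                   ≡⟨ HC-suc≡sumAntidiagonal u ⟩
    sumAntidiagonal u term                       ≡⟨ sumAntidiagonal≡sumFrom1 u term ⟩
    sumFrom1 (suc u) termⱼ + term u (u ∸ u)      ≡⟨ +-comm (sumFrom1 (suc u) termⱼ) _ ⟩
    term u (u ∸ u) + sumFrom1 (suc u) termⱼ
      ≡⟨ cong₂ _+_ last-term (sumFrom1-cong (suc u) inner-term) ⟩
    HC u + sumFrom1 (suc u) (λ j → HC (j ∸ 1) * Cat (suc u ∸ j) + Cat (j ∸ 1) * HC (suc u ∸ j)) ∎
    where
    u : ℕ
    u = suc k
    term : ℕ → ℕ → ℕ
    term a b = HC a * Cat b + Cat a * totalHumps b
    termⱼ : ℕ → ℕ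
    termⱼ j = term (j ∸ 1) (suc u ∸ j)

    last-term : term u (u ∸ u) ≡ HC u
    last-term rewrite n∸n≡0 u =
      trans (cong₂ _+_ (*-identityʳ (HC u)) (*-zeroʳ (Cat u))) (+-identityʳ (HC u))

    inner-term : ∀ j → suc j < suc u →
                 termⱼ (suc j) ≡ HC j * Cat (u ∸ j) + Cat j * HC (u ∸ j)
    inner-term j (s≤s j<u) rewrite +-∸-assoc 1 j<u =
      cong (λ t → HC j * Cat (suc (k ∸ j)) + Cat j * t) (sym (HC-suc (k ∸ j)))
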